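{- Let $\theta\ge 0$ be an integer and consider the two-color (black/white) urn with replacement matrix $$\begin{pmatrix} \mathcal{X} & \theta-\mathcal{X}\\ \theta-\mathcal{X} & \mathcal{X}\end{pmatrix},$$ where $\mathcal{X}$ is Binomial$(\theta,1/2)$-distributed, started from a deterministic nonempty configuration $(B_0,W_0)=(b_0,w_0)$. Then for every $n\ge 0$ the number $B_n$ of black balls after $n$ draws satisfies $$\Pr(B_n=b)=\frac{1}{2^{\theta n}}\binom{\theta n}{b-b_0},\qquad b\in\{b_0,b_0+1,\dots,b_0+\theta n\},$$ i.e. $B_n$ is distributed as $b_0+\mathrm{Bin}(\theta n,1/2)$.
   Context: At each step a ball is drawn uniformly at random and put back, and an independent fresh realization $k$ of $\mathcal{X}$ is generated. If the drawn ball is black, $k$ black balls and $\theta-k$ white balls are added; if it is white, $\theta-k$ black balls and $k$ white balls are added. -}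

module Defs where

open import Data.Nat as ℕ using (ℕ; zero; suc; _∸_; _^_; _≡ᵇ_)
open import Data.Nat.Combinatorics using (_C_)
open import Data.Integer using (+_)
open import Data.Rational using (ℚ; 0ℚ; 1ℚ; _/_; _+_; _*_)
open import Data.List using (List; map; foldr; upTo)
open import Data.Bool using (if_then_else_)

-- a / d as a rational; returns 0 when d = 0 (never used with d = 0 below
-- under the hypothesis b₀ + w₀ > 0).
frac : ℕ → ℕ → ℚ
frac a zero    = 0ℚ
frac a (suc d) = (+ a) / suc d

sumTo : ℕ → (ℕ → ℚ) → ℚ
sumTo m f = foldr _+_ 0ℚ (map f (upTo m))

ind : ℕ → ℕ → ℚ
ind x y = if x ≡ᵇ y then 1ℚ else 0ℚ

binHalf : ℕ → ℕ → ℚ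
binHalf θ k = frac (θ C k) (2 ^ θ)

total : ℕ → ℕ → ℕ → ℕ → ℕ
total θ b₀ w₀ n = b₀ ℕ.+ w₀ ℕ.+ θ ℕ.* n

-- Law of B_n: lawB θ b₀ w₀ n b = Pr(B_n = b) for the urn with replacement
-- matrix ((𝒳, θ-𝒳), (θ-𝒳, 𝒳)), 𝒳 ~ Bin(θ,1/2) fresh at each step,
-- started from (B₀, W₀) = (b₀, w₀).  Since B_n + W_n = total θ b₀ w₀ n
-- deterministically, B_n determines the state; B_n ∈ {0,…,total n}.
-- One step from B_n = c (T = total n balls):
--   draw black w.p. c/T, then B_{n+1} = c + k   w.p. P(𝒳 = k)
--   draw white w.p. (T-c)/T, then B_{n+1} = c + (θ - k) w.p. P(𝒳 = k)
lawB : ℕ → ℕ → ℕ → ℕ → ℕ → ℚ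
lawB θ b₀ w₀ zero    b = ind b b₀
lawB θ b₀ w₀ (suc n) b =
  sumTo (suc T) λ c → lawB θ b₀ w₀ n c *
    sumTo (suc θ) λ k → binHalf θ k *
      (frac c T * ind b (c ℕ.+ k) + frac (T ∸ c) T * ind b (c ℕ.+ (θ ∸ k)))
  where
  T : ℕ
  T = total θ b₀ w₀ n

module Submission where

-- From B = c the urn moves to c + k with probability P(𝒳 = k)
-- after a black draw and to c + (θ - k) after a white draw.  Since the law
-- Bin(θ,1/2) is symmetric under k ↦ θ - k, both colours give the same
-- displacement law; the draw probabilities c/T and (T - c)/T then add up to
-- 1, so B_{n+1} = B_n + Bin(θ,1/2) whatever colour is drawn.  Iterating, the
-- laws convolve, and Vandermonde's identity gives B_n = b₀ + Bin(θn,1/2).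

open import Defs
open import Data.Nat using (ℕ; _+_; _*_; _∸_; _^_; _≤_; _<_)
open import Data.Nat.Combinatorics using (_C_)
open import Relation.Binary.PropositionalEquality using (_≡_)

open import Data.Nat using (zero; suc; _≡ᵇ_; NonZero; >-nonZero; z≤n; s≤s; s≤s⁻¹; z<s; s<s; _<?_)
open import Data.Nat.Properties
open import Data.Nat.Combinatorics using (nCk+nC[k+1]≡[n+1]C[k+1]; nCk≡nC[n∸k]; k>n⇒nCk≡0)
open import Data.Nat.Tactic.RingSolver using (solve-∀)
open import Data.Bool using (if_then_else_; true; false)
open import Data.List using (map; foldr; applyUpTo)
open import Data.Integer.Properties using (pos-*; pos-+)
import Data.Integer as ℤ
open import Data.Rational using (ℚ; 0ℚ; toℚᵘ; fromℚᵘ) renaming (_+_ to _+q_; _*_ to _*q_)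
open import Data.Rational.Properties
  using (toℚᵘ-injective; toℚᵘ-homo-+; toℚᵘ-homo-*; toℚᵘ-fromℚᵘ; fromℚᵘ-cong; 0/n≡0)
import Data.Rational.Unnormalised.Base as U
import Data.Rational.Unnormalised.Properties as UP
open import Relation.Binary.PropositionalEquality using (refl; sym; trans; cong; cong₂; module ≡-Reasoning)
open import Relation.Nullary using (yes; no)

+-via-ℚᵘ : ∀ p q → p +q q ≡ fromℚᵘ (toℚᵘ p U.+ toℚᵘ q)
+-via-ℚᵘ p q = toℚᵘ-injective (UP.≃-trans (toℚᵘ-homo-+ p q) (UP.≃-sym (toℚᵘ-fromℚᵘ _)))

*-via-ℚᵘ : ∀ p q → p *q q ≡ fromℚᵘ (toℚᵘ p U.* toℚᵘ q)
*-via-ℚᵘ p q = toℚᵘ-injective (UP.≃-trans (toℚᵘ-homo-* p q) (UP.≃-sym (toℚᵘ-fromℚᵘ _)))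

frac-cong : ∀ a b d e .{{_ : NonZero d}} .{{_ : NonZero e}} →
            a * e ≡ b * d → frac a d ≡ frac b e
frac-cong a b (suc d) (suc e) eq =
  fromℚᵘ-cong {U.mkℚᵘ (ℤ.+ a) d} {U.mkℚᵘ (ℤ.+ b) e}
    (U.*≡* (trans (sym (pos-* a (suc e))) (trans (cong ℤ.+_ eq) (pos-* b (suc d)))))

frac-+ : ∀ a b d e .{{_ : NonZero d}} .{{_ : NonZero e}} →
         frac a d +q frac b e ≡ frac (a * e + b * d) (d * e)
frac-+ a b (suc d) (suc e) = trans (+-via-ℚᵘ (frac a (suc d)) (frac b (suc e)))
  (fromℚᵘ-cong (UP.≃-trans unnormalise (UP.≃-reflexive (cong (λ z → U.mkℚᵘ z (e + d * suc e)) numerator))))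
  where
  numerator : ℤ.+ a ℤ.* ℤ.+ suc e ℤ.+ ℤ.+ b ℤ.* ℤ.+ suc d ≡ ℤ.+ (a * suc e + b * suc d)
  numerator = trans (cong₂ ℤ._+_ (sym (pos-* a (suc e))) (sym (pos-* b (suc d))))
                    (sym (pos-+ (a * suc e) (b * suc d)))
  unnormalise : toℚᵘ (frac a (suc d)) U.+ toℚᵘ (frac b (suc e)) U.≃ U.mkℚᵘ (ℤ.+ a) d U.+ U.mkℚᵘ (ℤ.+ b) e
  unnormalise = UP.+-cong (toℚᵘ-fromℚᵘ (U.mkℚᵘ (ℤ.+ a) d)) (toℚᵘ-fromℚᵘ (U.mkℚᵘ (ℤ.+ b) e))

frac-* : ∀ a b d e .{{_ : NonZero d}} .{{_ : NonZero e}} →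
         frac a d *q frac b e ≡ frac (a * b) (d * e)
frac-* a b (suc d) (suc e) = trans (*-via-ℚᵘ (frac a (suc d)) (frac b (suc e)))
  (fromℚᵘ-cong (UP.≃-trans unnormalise
    (UP.≃-reflexive (cong (λ z → U.mkℚᵘ z (e + d * suc e)) (sym (pos-* a b))))))
  where
  unnormalise : toℚᵘ (frac a (suc d)) U.* toℚᵘ (frac b (suc e)) U.≃ U.mkℚᵘ (ℤ.+ a) d U.* U.mkℚᵘ (ℤ.+ b) e
  unnormalise = UP.*-cong (toℚᵘ-fromℚᵘ (U.mkℚᵘ (ℤ.+ a) d)) (toℚᵘ-fromℚᵘ (U.mkℚᵘ (ℤ.+ b) e))

frac-+-same : ∀ a b d .{{_ : NonZero d}} → frac a d +q frac b d ≡ frac (a + b) d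
frac-+-same a b d@(suc _) = trans (frac-+ a b d d) (frac-cong (a * d + b * d) (a + b) (d * d) d (ring a b d))
  where
  ring : ∀ a b d → (a * d + b * d) * d ≡ (a + b) * (d * d)
  ring = solve-∀

frac-*-integer : ∀ a i d .{{_ : NonZero d}} → frac a d *q frac i 1 ≡ frac (a * i) d
frac-*-integer a i d@(suc _) = trans (frac-* a i d 1) (frac-cong (a * i) (a * i) (d * 1) d (ring a i d))
  where
  ring : ∀ a i d → a * i * d ≡ a * i * (d * 1)
  ring = solve-∀

frac-cancel : ∀ t x d .{{_ : NonZero t}} .{{_ : NonZero d}} → frac (t * x) (d * t) ≡ frac x d
frac-cancel t@(suc _) x d@(suc _) = frac-cong (t * x) x (d * t) d (ring t x d)
  where
  ring : ∀ t x d → t * x * d ≡ x * (d * t)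
  ring = solve-∀

frac-zero : ∀ d → frac 0 d ≡ 0ℚ
frac-zero zero    = refl
frac-zero (suc d) = 0/n≡0 (suc d)

sumℕ : ℕ → (ℕ → ℕ) → ℕ
sumℕ zero    f = 0
sumℕ (suc m) f = f 0 + sumℕ m (λ i → f (suc i))

sumℕ-cong : ∀ m {f g : ℕ → ℕ} → (∀ i → i < m → f i ≡ g i) → sumℕ m f ≡ sumℕ m g
sumℕ-cong zero    f≡g = refl
sumℕ-cong (suc m) f≡g = cong₂ _+_ (f≡g 0 z<s) (sumℕ-cong m (λ i i<m → f≡g (suc i) (s<s i<m)))

sumℕ-zero : ∀ m {f : ℕ → ℕ} → (∀ i → i < m → f i ≡ 0) → sumℕ m f ≡ 0
sumℕ-zero zero    f≡0 = refl
sumℕ-zero (suc m) f≡0 = cong₂ _+_ (f≡0 0 z<s) (sumℕ-zero m (λ i i<m → f≡0 (suc i) (s<s i<m)))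

sumℕ-+ : ∀ m (f g : ℕ → ℕ) → sumℕ m (λ i → f i + g i) ≡ sumℕ m f + sumℕ m g
sumℕ-+ zero    f g = refl
sumℕ-+ (suc m) f g = trans (cong (f 0 + g 0 +_) (sumℕ-+ m _ _)) (ring (f 0) (g 0) (sumℕ m _) (sumℕ m _))
  where
  ring : ∀ a b c d → a + b + (c + d) ≡ a + c + (b + d)
  ring = solve-∀

sumℕ-*ˡ : ∀ m a (f : ℕ → ℕ) → sumℕ m (λ i → a * f i) ≡ a * sumℕ m f
sumℕ-*ˡ zero    a f = sym (*-zeroʳ a)
sumℕ-*ˡ (suc m) a f = trans (cong (a * f 0 +_) (sumℕ-*ˡ m a _)) (sym (*-distribˡ-+ a (f 0) _))

sumℕ-snoc : ∀ m (f : ℕ → ℕ) → sumℕ (suc m) f ≡ sumℕ m f + f m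
sumℕ-snoc zero    f = +-comm (f 0) 0
sumℕ-snoc (suc m) f = trans (cong (f 0 +_) (sumℕ-snoc m _)) (sym (+-assoc (f 0) _ _))

sumℕ-extend : ∀ k d (f : ℕ → ℕ) → (∀ i → k ≤ i → f i ≡ 0) → sumℕ (k + d) f ≡ sumℕ k f
sumℕ-extend zero    d f f≡0 = sumℕ-zero d (λ i _ → f≡0 i z≤n)
sumℕ-extend (suc k) d f f≡0 = cong (f 0 +_) (sumℕ-extend k d _ (λ i k≤i → f≡0 (suc i) (s≤s k≤i)))

sumℕ-reflect : ∀ M (f : ℕ → ℕ) → sumℕ (suc M) f ≡ sumℕ (suc M) (λ k → f (M ∸ k))
sumℕ-reflect zero    f = refl
sumℕ-reflect (suc M) f = begin
  f 0 + sumℕ (suc M) (λ i → f (suc i))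
    ≡⟨ cong (f 0 +_) (sumℕ-reflect M (λ i → f (suc i))) ⟩
  f 0 + sumℕ (suc M) (λ k → f (suc (M ∸ k)))
    ≡⟨ +-comm (f 0) _ ⟩
  sumℕ (suc M) (λ k → f (suc (M ∸ k))) + f 0
    ≡⟨ cong₂ _+_ (sumℕ-cong (suc M) (λ k k≤M → cong f (sym (+-∸-assoc 1 (s≤s⁻¹ k≤M)))))
                 (cong f (sym (n∸n≡0 (suc M)))) ⟩
  sumℕ (suc M) (λ k → f (suc M ∸ k)) + f (suc M ∸ suc M)
    ≡⟨ sym (sumℕ-snoc (suc M) (λ k → f (suc M ∸ k))) ⟩
  sumℕ (suc (suc M)) (λ k → f (suc M ∸ k)) ∎
  where open ≡-Reasoning

δ : ℕ → ℕ → ℕ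
δ x y = if x ≡ᵇ y then 1 else 0

select-in-range : ∀ M (f : ℕ → ℕ) b → b < M → sumℕ M (λ k → f k * δ b k) ≡ f b
select-in-range (suc M) f zero    _   =
  trans (cong₂ _+_ (*-identityʳ (f 0)) (sumℕ-zero M (λ i _ → *-zeroʳ (f (suc i))))) (+-identityʳ (f 0))
select-in-range (suc M) f (suc b) b<M =
  cong₂ _+_ (*-zeroʳ (f 0)) (select-in-range M (λ i → f (suc i)) b (s≤s⁻¹ b<M))

select-out-of-range : ∀ M (f : ℕ → ℕ) b → M ≤ b → sumℕ M (λ k → f k * δ b k) ≡ 0
select-out-of-range zero    f b       _   = refl
select-out-of-range (suc M) f (suc b) M≤b =
  cong₂ _+_ (*-zeroʳ (f 0)) (select-out-of-range M (λ i → f (suc i)) b (s≤s⁻¹ M≤b))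

-- Shifted binomial coefficient: shiftC m a b = C(m, b - a) if a ≤ b, else 0.
-- Up to the factor 2^m it is the law of a + Bin(m,1/2) at b.
shiftC : ℕ → ℕ → ℕ → ℕ
shiftC m zero    b       = m C b
shiftC m (suc a) zero    = 0
shiftC m (suc a) (suc b) = shiftC m a b

shiftC-≤ : ∀ m a b → a ≤ b → shiftC m a b ≡ m C (b ∸ a)
shiftC-≤ m zero    b       _   = refl
shiftC-≤ m (suc a) (suc b) a≤b = shiftC-≤ m a b (s≤s⁻¹ a≤b)

binomial-displacement : ∀ θ M c b → θ < M → sumℕ M (λ k → (θ C k) * δ b (c + k)) ≡ shiftC θ c b
binomial-displacement θ M zero b θ<M with b <? M
... | yes b<M = select-in-range M (θ C_) b b<M
... | no  b≮M = trans (select-out-of-range M (θ C_) b (≮⇒≥ b≮M))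
                      (sym (k>n⇒nCk≡0 (<-≤-trans θ<M (≮⇒≥ b≮M))))
binomial-displacement θ M (suc c) zero    θ<M = sumℕ-zero M (λ k _ → *-zeroʳ (θ C k))
binomial-displacement θ M (suc c) (suc b) θ<M = binomial-displacement θ M c b θ<M

binomial-reflection : ∀ θ b c → sumℕ (suc θ) (λ k → (θ C k) * δ b (c + (θ ∸ k)))
                                ≡ sumℕ (suc θ) (λ k → (θ C k) * δ b (c + k))
binomial-reflection θ b c = sym (trans (sumℕ-reflect θ (λ k → (θ C k) * δ b (c + k)))
  (sumℕ-cong (suc θ) (λ k k<1+θ → cong (_* δ b (c + (θ ∸ k))) (sym (nCk≡nC[n∸k] (s≤s⁻¹ k<1+θ))))))

vandermonde : ∀ θ m r → sumℕ (suc m) (λ c → (m C c) * shiftC θ c r) ≡ (θ + m) C r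
vandermonde θ zero    r       = trans (+-identityʳ _) (trans (+-identityʳ _) (cong (_C r) (sym (+-identityʳ θ))))
vandermonde θ (suc m) zero    = cong (1 +_) (sumℕ-zero (suc m) (λ i _ → *-zeroʳ (suc m C suc i)))
vandermonde θ (suc m) (suc r) = begin
  (suc m C 0) * A + sumℕ (suc m) (λ i → (suc m C suc i) * shiftC θ i r)
    ≡⟨ cong₂ _+_ (*-identityˡ A) (sumℕ-cong (suc m) (λ i _ → cong (_* shiftC θ i r) (sym (nCk+nC[k+1]≡[n+1]C[k+1] m i)))) ⟩
  A + sumℕ (suc m) (λ i → (m C i + m C suc i) * shiftC θ i r)
    ≡⟨ cong (A +_) (trans (sumℕ-cong (suc m) (λ i _ → *-distribʳ-+ (shiftC θ i r) (m C i) (m C suc i)))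
                          (sumℕ-+ (suc m) (λ i → (m C i) * shiftC θ i r) (λ i → (m C suc i) * shiftC θ i r))) ⟩
  A + (X + sumℕ (suc m) (λ i → (m C suc i) * shiftC θ i r))
    ≡⟨ cong (λ z → A + (X + z)) (sumℕ-snoc m (λ i → (m C suc i) * shiftC θ i r)) ⟩
  A + (X + (Y + (m C suc m) * shiftC θ m r))
    ≡⟨ cong (λ z → A + (X + (Y + z * shiftC θ m r))) (k>n⇒nCk≡0 (n<1+n m)) ⟩
  A + (X + (Y + 0))
    ≡⟨ ring A X Y ⟩
  X + ((m C 0) * A + Y)
    ≡⟨ cong₂ _+_ (vandermonde θ m r) (vandermonde θ m (suc r)) ⟩
  (θ + m) C r + (θ + m) C suc r
    ≡⟨ nCk+nC[k+1]≡[n+1]C[k+1] (θ + m) r ⟩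
  suc (θ + m) C suc r
    ≡⟨ cong (_C suc r) (sym (+-suc θ m)) ⟩
  (θ + suc m) C suc r ∎
  where
  open ≡-Reasoning
  A = θ C suc r
  X = sumℕ (suc m) (λ i → (m C i) * shiftC θ i r)
  Y = sumℕ m (λ i → (m C suc i) * shiftC θ i r)
  ring : ∀ a x y → a + (x + (y + 0)) ≡ x + (1 * a + y)
  ring = solve-∀

-- Vandermonde for shifted coefficients (convolution of a + Bin(m) with the
-- displacement Bin(θ)), summed over any range c < a + L that covers a + m.
vandermonde-shifted : ∀ θ m a L b → m < L →
  sumℕ (a + L) (λ c → shiftC m a c * shiftC θ c b) ≡ shiftC (θ + m) a b
vandermonde-shifted θ m zero L b m<L = begin
  sumℕ L f
    ≡⟨ cong (λ z → sumℕ z f) (sym (m+[n∸m]≡n m<L)) ⟩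
  sumℕ (suc m + (L ∸ suc m)) f
    ≡⟨ sumℕ-extend (suc m) (L ∸ suc m) f (λ i m<i → cong (_* shiftC θ i b) (k>n⇒nCk≡0 m<i)) ⟩
  sumℕ (suc m) f
    ≡⟨ vandermonde θ m b ⟩
  (θ + m) C b ∎
  where
  open ≡-Reasoning
  f = λ c → (m C c) * shiftC θ c b
vandermonde-shifted θ m (suc a) L zero    m<L = sumℕ-zero (a + L) (λ i _ → *-zeroʳ (shiftC m a i))
vandermonde-shifted θ m (suc a) L (suc b) m<L = vandermonde-shifted θ m a L b m<L

-- The symmetry argument: with T balls of which c ≤ T are black, the numerator
-- of P(B_{n+1} = b | B_n = c) over the denominator 2^θ · T is
-- T · shiftC θ c b, i.e. the colour drawn does not matter.
one-step-count : ∀ θ T c b → c ≤ T →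
  sumℕ (suc θ) (λ k → (θ C k) * (c * δ b (c + k) + (T ∸ c) * δ b (c + (θ ∸ k))))
  ≡ T * shiftC θ c b
one-step-count θ T c b c≤T = begin
  sumℕ (suc θ) (λ k → (θ C k) * (c * δ b (c + k) + (T ∸ c) * δ b (c + (θ ∸ k))))
    ≡⟨ sumℕ-cong (suc θ) (λ k _ → ring (θ C k) c (δ b (c + k)) (T ∸ c) (δ b (c + (θ ∸ k)))) ⟩
  sumℕ (suc θ) (λ k → c * black k + (T ∸ c) * white k)
    ≡⟨ sumℕ-+ (suc θ) (λ k → c * black k) (λ k → (T ∸ c) * white k) ⟩
  sumℕ (suc θ) (λ k → c * black k) + sumℕ (suc θ) (λ k → (T ∸ c) * white k)
    ≡⟨ cong₂ _+_ (sumℕ-*ˡ (suc θ) c black) (sumℕ-*ˡ (suc θ) (T ∸ c) white) ⟩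
  c * sumℕ (suc θ) black + (T ∸ c) * sumℕ (suc θ) white
    ≡⟨ cong (λ z → c * sumℕ (suc θ) black + (T ∸ c) * z) (binomial-reflection θ b c) ⟩
  c * sumℕ (suc θ) black + (T ∸ c) * sumℕ (suc θ) black
    ≡⟨ sym (*-distribʳ-+ (sumℕ (suc θ) black) c (T ∸ c)) ⟩
  (c + (T ∸ c)) * sumℕ (suc θ) black
    ≡⟨ cong₂ _*_ (m+[n∸m]≡n c≤T) (binomial-displacement θ (suc θ) c b (n<1+n θ)) ⟩
  T * shiftC θ c b ∎
  where
  open ≡-Reasoning
  black white : ℕ → ℕ
  black k = (θ C k) * δ b (c + k)
  white k = (θ C k) * δ b (c + (θ ∸ k))
  ring : ∀ x c i t j → x * (c * i + t * j) ≡ c * (x * i) + t * (x * j)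
  ring = solve-∀

sumℚ : ℕ → (ℕ → ℚ) → ℚ
sumℚ zero    f = 0ℚ
sumℚ (suc m) f = f 0 +q sumℚ m (λ i → f (suc i))

sumTo≡sumℚ : ∀ m f → sumTo m f ≡ sumℚ m f
sumTo≡sumℚ m f = fold m (λ i → i)
  where
  fold : ∀ m (g : ℕ → ℕ) → foldr _+q_ 0ℚ (map f (applyUpTo g m)) ≡ sumℚ m (λ i → f (g i))
  fold zero    g = refl
  fold (suc m) g = cong (f (g 0) +q_) (fold m (λ i → g (suc i)))

sumℚ-cong : ∀ m {f g : ℕ → ℚ} → (∀ i → i < m → f i ≡ g i) → sumℚ m f ≡ sumℚ m g
sumℚ-cong zero    f≡g = refl
sumℚ-cong (suc m) f≡g = cong₂ _+q_ (f≡g 0 z<s) (sumℚ-cong m (λ i i<m → f≡g (suc i) (s<s i<m)))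

sumℚ-frac : ∀ m (f : ℕ → ℕ) d .{{_ : NonZero d}} → sumℚ m (λ i → frac (f i) d) ≡ frac (sumℕ m f) d
sumℚ-frac zero    f d = sym (frac-zero d)
sumℚ-frac (suc m) f d = trans (cong (frac (f 0) d +q_) (sumℚ-frac m (λ i → f (suc i)) d)) (frac-+-same (f 0) _ d)

ind≡frac-δ : ∀ x y → ind x y ≡ frac (δ x y) 1
ind≡frac-δ x y with x ≡ᵇ y
... | true  = refl
... | false = refl

transition-law : ∀ θ T c b .{{_ : NonZero T}} → c ≤ T →
  sumTo (suc θ) (λ k → binHalf θ k *q (frac c T *q ind b (c + k) +q frac (T ∸ c) T *q ind b (c + (θ ∸ k))))
  ≡ frac (shiftC θ c b) (2 ^ θ)
transition-law θ T c b c≤T = begin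
  sumTo (suc θ) term
    ≡⟨ sumTo≡sumℚ (suc θ) term ⟩
  sumℚ (suc θ) term
    ≡⟨ sumℚ-cong (suc θ) (λ k _ → term≡ k) ⟩
  sumℚ (suc θ) (λ k → frac (count k) (2 ^ θ * T))
    ≡⟨ sumℚ-frac (suc θ) count (2 ^ θ * T) ⟩
  frac (sumℕ (suc θ) count) (2 ^ θ * T)
    ≡⟨ cong (λ z → frac z (2 ^ θ * T)) (one-step-count θ T c b c≤T) ⟩
  frac (T * shiftC θ c b) (2 ^ θ * T)
    ≡⟨ frac-cancel T (shiftC θ c b) (2 ^ θ) ⟩
  frac (shiftC θ c b) (2 ^ θ) ∎
  where
  open ≡-Reasoning
  instance
    2^θ≢0 : NonZero (2 ^ θ)
    2^θ≢0 = m^n≢0 2 θ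
    2^θ*T≢0 : NonZero (2 ^ θ * T)
    2^θ*T≢0 = m*n≢0 (2 ^ θ) T
  term : ℕ → ℚ
  term k = binHalf θ k *q (frac c T *q ind b (c + k) +q frac (T ∸ c) T *q ind b (c + (θ ∸ k)))
  count : ℕ → ℕ
  count k = (θ C k) * (c * δ b (c + k) + (T ∸ c) * δ b (c + (θ ∸ k)))
  weigh : ∀ a x → frac a T *q ind b x ≡ frac (a * δ b x) T
  weigh a x = trans (cong (frac a T *q_) (ind≡frac-δ b x)) (frac-*-integer a (δ b x) T)
  term≡ : ∀ k → term k ≡ frac (count k) (2 ^ θ * T)
  term≡ k = begin
    term k
      ≡⟨ cong (binHalf θ k *q_) (cong₂ _+q_ (weigh c (c + k)) (weigh (T ∸ c) (c + (θ ∸ k)))) ⟩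
    binHalf θ k *q (frac (c * δ b (c + k)) T +q frac ((T ∸ c) * δ b (c + (θ ∸ k))) T)
      ≡⟨ cong (binHalf θ k *q_) (frac-+-same _ _ T) ⟩
    binHalf θ k *q frac (c * δ b (c + k) + (T ∸ c) * δ b (c + (θ ∸ k))) T
      ≡⟨ frac-* (θ C k) _ (2 ^ θ) T ⟩
    frac (count k) (2 ^ θ * T) ∎

initial-law : ∀ b₀ b → ind b b₀ ≡ frac (shiftC 0 b₀ b) 1
initial-law b₀ b = trans (ind≡frac-δ b b₀) (cong (λ z → frac z 1) (point-mass b₀ b))
  where
  point-mass : ∀ b₀ b → δ b b₀ ≡ shiftC 0 b₀ b
  point-mass zero     zero    = refl
  point-mass zero     (suc b) = refl
  point-mass (suc b₀) zero    = refl
  point-mass (suc b₀) (suc b) = point-mass b₀ b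

lawB-closed : ∀ θ b₀ w₀ → 0 < b₀ + w₀ → ∀ n b →
  lawB θ b₀ w₀ n b ≡ frac (shiftC (θ * n) b₀ b) (2 ^ (θ * n))
lawB-closed θ b₀ w₀ pos zero    b rewrite *-zeroʳ θ = initial-law b₀ b
lawB-closed θ b₀ w₀ pos (suc n) b = begin
  lawB θ b₀ w₀ (suc n) b
    ≡⟨ sumTo≡sumℚ (suc T) (λ c → lawB θ b₀ w₀ n c *q transition c) ⟩
  sumℚ (suc T) (λ c → lawB θ b₀ w₀ n c *q transition c)
    ≡⟨ sumℚ-cong (suc T) (λ c c<1+T → cong₂ _*q_ (lawB-closed θ b₀ w₀ pos n c)
                                                 (transition-law θ T c b (s≤s⁻¹ c<1+T))) ⟩
  sumℚ (suc T) (λ c → frac (shiftC m b₀ c) (2 ^ m) *q frac (shiftC θ c b) (2 ^ θ))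
    ≡⟨ sumℚ-cong (suc T) (λ c _ → frac-* (shiftC m b₀ c) (shiftC θ c b) (2 ^ m) (2 ^ θ)) ⟩
  sumℚ (suc T) (λ c → frac (path c) (2 ^ m * 2 ^ θ))
    ≡⟨ sumℚ-frac (suc T) path (2 ^ m * 2 ^ θ) ⟩
  frac (sumℕ (suc T) path) (2 ^ m * 2 ^ θ)
    ≡⟨ cong (λ z → frac z (2 ^ m * 2 ^ θ)) paths ⟩
  frac (shiftC (θ + m) b₀ b) (2 ^ m * 2 ^ θ)
    ≡⟨ cong₂ (λ x y → frac (shiftC x b₀ b) y) (sym (*-suc θ n)) (sym powers) ⟩
  frac (shiftC (θ * suc n) b₀ b) (2 ^ (θ * suc n)) ∎
  where
  open ≡-Reasoning
  m = θ * n
  T = total θ b₀ w₀ n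
  instance
    T≢0 : NonZero T
    T≢0 = >-nonZero (<-≤-trans pos (m≤m+n (b₀ + w₀) m))
    2^m≢0 : NonZero (2 ^ m)
    2^m≢0 = m^n≢0 2 m
    2^θ≢0 : NonZero (2 ^ θ)
    2^θ≢0 = m^n≢0 2 θ
    2^m*2^θ≢0 : NonZero (2 ^ m * 2 ^ θ)
    2^m*2^θ≢0 = m*n≢0 (2 ^ m) (2 ^ θ)
  transition : ℕ → ℚ
  transition c = sumTo (suc θ) (λ k → binHalf θ k *q
    (frac c T *q ind b (c + k) +q frac (T ∸ c) T *q ind b (c + (θ ∸ k))))
  path : ℕ → ℕ
  path c = shiftC m b₀ c * shiftC θ c b
  paths : sumℕ (suc T) path ≡ shiftC (θ + m) b₀ b
  paths = trans (cong (λ z → sumℕ z path) (trans (cong suc (+-assoc b₀ w₀ m)) (sym (+-suc b₀ (w₀ + m)))))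
                (vandermonde-shifted θ m b₀ (suc (w₀ + m)) b (s≤s (m≤n+m m w₀)))
  powers : 2 ^ (θ * suc n) ≡ 2 ^ m * 2 ^ θ
  powers = trans (cong (2 ^_) (*-suc θ n)) (trans (^-distribˡ-+-* 2 θ m) (*-comm (2 ^ θ) (2 ^ m)))

-- For b₀ ≤ b the closed form is C(θn, b - b₀)/2^(θn).
proposition2 : (θ b₀ w₀ : ℕ) → 0 < b₀ + w₀ →
    (n b : ℕ) → b₀ ≤ b → b ≤ b₀ + θ * n →
      lawB θ b₀ w₀ n b ≡ frac ((θ * n) C (b ∸ b₀)) (2 ^ (θ * n))
proposition2 θ b₀ w₀ pos n b b₀≤b _ =
  trans (lawB-closed θ b₀ w₀ pos n b) (cong (λ z → frac z (2 ^ (θ * n))) (shiftC-≤ (θ * n) b₀ b b₀≤b))
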